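{- Let $X_1,X_2,Y$ be NUTS. The bijection $\alpha:((|X_1|\times|X_2|)\times|Y|)\to(|X_1|\times(|X_2|\times|Y|))$, $((a_1,a_2),b)\mapsto(a_1,(a_2,b))$, is an isomorphism in $\mathbf{NUTS}$ from $(X_1\otimes X_2)\multimap Y$ to $X_1\multimap(X_2\multimap Y)$.
   Context: For $\mathcal T\subseteq\mathcal P(E)$, $\mathcal T^\perp=\{u'\subseteq E\mid\forall u\in\mathcal T,\ u\cap u'\neq\emptyset\}$. A NUTS is $X=(|X|,\mathcal T(X))$ with $\mathcal T(X)\subseteq\mathcal P(|X|)$ and $\mathcal T(X)=\mathcal T(X)^{\perp\perp}$; $X^\perp=(|X|,\mathcal T(X)^\perp)$, $X\otimes Y=(|X|\times|Y|,\{u\times v\mid u\in\mathcal T(X),v\in\mathcal T(Y)\}^{\perp\perp})$, $X\multimap Y=(X\otimes Y^\perp)^\perp$. The category $\mathbf{NUTS}$ has $\mathbf{NUTS}(X,Y)=\mathcal T(X\multimap Y)$ with relational composition and diagonal identities; the bijection $\alpha$ is viewed as the relation given by its graph. -}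

module Defs where

open import Level using (0ℓ)
open import Data.Product using (Σ; ∃; ∃-syntax; _×_; _,_; proj₁; proj₂)
open import Relation.Unary using (Pred; _≐_)
open import Relation.Binary.PropositionalEquality using (_≡_)

Subset : Set → Set₁
Subset E = Pred E 0ℓ

Family : Set → Set₂
Family E = Pred (Subset E) (Level.suc 0ℓ)

_⊥ : {E : Set} → Family E → Family E
(T ⊥) u' = ∀ u → T u → ∃[ x ] (u x × u' x)

_≐F_ : {E : Set} → Family E → Family E → Set₁
T ≐F T' = (∀ u → T u → T' u) × (∀ u → T' u → T u)

record NUTS : Set₂ where
  field
    web  : Set
    tot  : Family web
    biorth : tot ≐F ((tot ⊥) ⊥)
open NUTS public

_×ₛ_ : {A B : Set} → Subset A → Subset B → Subset (A × B)
(u ×ₛ v) (a , b) = u a × v b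

_^⊥ : NUTS → NUTS
web (X ^⊥) = web X
tot (X ^⊥) = tot X ⊥
proj₁ (biorth (X ^⊥)) u p = λ w q → let (x , a , b) = q u p in x , b , a
proj₂ (biorth (X ^⊥)) u p = p' u p
  where
  p' : ∀ u → (((tot X ⊥) ⊥) ⊥) u → (tot X ⊥) u
  p' u h w tw = h w (λ u' tu' → let (x , a , b) = tu' w tw in x , b , a)

tensorGen : (X Y : NUTS) → Family (web X × web Y)
tensorGen X Y w = ∃[ u ] ∃[ v ] (tot X u × tot Y v × (w ≐ (u ×ₛ v)))

_⊗_ : NUTS → NUTS → NUTS
web (X ⊗ Y) = web X × web Y
tot (X ⊗ Y) = (tensorGen X Y ⊥) ⊥
proj₁ (biorth (X ⊗ Y)) u p = λ w q → let (x , a , b) = q u p in x , b , a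
proj₂ (biorth (X ⊗ Y)) u p w tw = p w (λ u' tu' → let (x , a , b) = tu' w tw in x , b , a)

_⊸_ : NUTS → NUTS → NUTS
X ⊸ Y = (X ⊗ (Y ^⊥)) ^⊥

Rel : NUTS → NUTS → Set₁
Rel X Y = Subset (web X × web Y)

Hom : (X Y : NUTS) → Rel X Y → Set₁
Hom X Y R = tot (X ⊸ Y) R

_∘ᵣ_ : {X Y Z : NUTS} → Rel Y Z → Rel X Y → Rel X Z
_∘ᵣ_ {Y = Y} S R (a , c) = ∃[ b ] (R (a , b) × S (b , c))

idᵣ : (X : NUTS) → Rel X X
idᵣ X (a , a') = a ≡ a'

IsIso : (X Y : NUTS) → Rel X Y → Set₁
IsIso X Y R = Hom X Y R × ∃[ S ] (Hom Y X S
              × ((_∘ᵣ_ {X} {Y} {X} S R) ≐ idᵣ X)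
              × ((_∘ᵣ_ {Y} {X} {Y} R S) ≐ idᵣ Y))

α : {A B C : Set} → (A × B) × C → A × (B × C)
α ((a , b) , c) = a , (b , c)

graph : {A B : Set} → (A → B) → Subset (A × B)
graph f (a , b) = f a ≡ b

-- A relation R is total in X ⊸ Y exactly when its direct image sends totals of X to totals
-- of Y, and the totals of X ⊗ Y are generated by the rectangles u × v. So, read through
-- images, the transport of R along α is the currying of R: maps out of X₁ ⊗ X₂ are
-- determined by their values on rectangles, i.e. by pairs u₁, u₂. The graph of the
-- inverse bijection is total by the same argument run backwards, and the composites of
-- the two graphs are the diagonals.
module Submission where

open import Defs
open import Data.Product using (∃-syntax; _×_; _,_; proj₁; proj₂)
open import Relation.Unary using (_⊆_; _≐_)
open import Relation.Unary.Properties using (≬-sym)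
open import Relation.Binary.PropositionalEquality using (_≡_; refl; sym)

⊆-⊥⊥ : {E : Set} (T : Family E) (u : Subset E) → T u → ((T ⊥) ⊥) u
⊆-⊥⊥ T u tu u' tu' = ≬-sym (tu' u tu)

⊥⊥⊥-⊆-⊥ : {E : Set} (T : Family E) (u : Subset E) → (((T ⊥) ⊥) ⊥) u → (T ⊥) u
⊥⊥⊥-⊆-⊥ T u h w tw = h w (⊆-⊥⊥ T w tw)

tot-upward : (X : NUTS) {u u' : Subset (web X)} → u ⊆ u' → tot X u → tot X u'
tot-upward X {u} {u'} u⊆u' tu = proj₂ (biorth X) u' λ v tv →
  let (x , vx , ux) = proj₁ (biorth X) u tu v tv in x , vx , u⊆u' ux

rectangle-tot : (X Y : NUTS) {u : Subset (web X)} {v : Subset (web Y)} →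
                tot X u → tot Y v → tot (X ⊗ Y) (u ×ₛ v)
rectangle-tot X Y {u} {v} tu tv =
  ⊆-⊥⊥ (tensorGen X Y) (u ×ₛ v) (u , v , tu , tv , (λ p → p) , (λ p → p))

image : {A B : Set} → Subset (A × B) → Subset A → Subset B
image R u b = ∃[ a ] (u a × R (a , b))

hom-intro : (X Y : NUTS) (R : Rel X Y) →
            (∀ u → tot X u → tot Y (image R u)) → Hom X Y R
hom-intro X Y R h = ⊆-⊥⊥ (tensorGen X (Y ^⊥) ⊥) R λ where
  w (u , v , tu , tv , w≐u×v) →
    let (b , vb , a , ua , Rab) = proj₁ (biorth Y) (image R u) (h u tu) v tv
    in (a , b) , proj₂ w≐u×v (ua , vb) , Rab

hom-elim : (X Y : NUTS) (R : Rel X Y) →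
           Hom X Y R → ∀ u → tot X u → tot Y (image R u)
hom-elim X Y R hom u tu = proj₂ (biorth Y) (image R u) λ v tv →
  let ((a , b) , (ua , vb) , Rab) =
        ⊥⊥⊥-⊆-⊥ (tensorGen X (Y ^⊥)) R hom (u ×ₛ v)
          (u , v , tu , tv , (λ p → p) , (λ p → p))
  in b , vb , a , ua , Rab

-- The witness w' collects the points of |X| × |Y| whose R-image meets the given
-- co-total v'; it is co-total in X ⊗ Y because R sends rectangles to totals.
image-⊗-tot : (X Y Z : NUTS) (R : Subset ((web X × web Y) × web Z)) →
              (∀ u v → tot X u → tot Y v → tot Z (image R (u ×ₛ v))) →
              ∀ w → tot (X ⊗ Y) w → tot Z (image R w)
image-⊗-tot X Y Z R rectangles w tw = proj₂ (biorth Z) (image R w) λ v' tv' →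
  let w' : Subset (web X × web Y)
      w' p = ∃[ z ] (R (p , z) × v' z)
      w'-cotot : (tensorGen X Y ⊥) w'
      w'-cotot g (u , v , tu , tv , g≐u×v) =
        let (z , v'z , p , up , Rpz) =
              proj₁ (biorth Z) (image R (u ×ₛ v)) (rectangles u v tu tv) v' tv'
        in p , proj₂ g≐u×v up , z , Rpz , v'z
      (p , (z , Rpz , v'z) , wp) = tw w' w'-cotot
  in z , v'z , p , wp , Rpz

α⁻¹ : {A B C : Set} → A × (B × C) → (A × B) × C
α⁻¹ (a , (b , c)) = (a , b) , c

curry-tot : (X₁ X₂ Y : NUTS) (R : Rel (X₁ ⊗ X₂) Y) →
            Hom (X₁ ⊗ X₂) Y R → Hom X₁ (X₂ ⊸ Y) (image (graph α) R)
curry-tot X₁ X₂ Y R hom =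
  hom-intro X₁ (X₂ ⊸ Y) _ λ u₁ tu₁ →
  hom-intro X₂ Y _ λ u₂ tu₂ →
  tot-upward Y (reassociate u₁ u₂)
    (hom-elim (X₁ ⊗ X₂) Y R hom (u₁ ×ₛ u₂) (rectangle-tot X₁ X₂ tu₁ tu₂))
  where
  reassociate : ∀ u₁ u₂ → image R (u₁ ×ₛ u₂) ⊆ image (image (image (graph α) R) u₁) u₂
  reassociate _ _ ((a₁ , a₂) , (ua₁ , ua₂) , Rpy) =
    a₂ , ua₂ , a₁ , ua₁ , _ , Rpy , refl

uncurry-tot : (X₁ X₂ Y : NUTS) (S : Rel X₁ (X₂ ⊸ Y)) →
              Hom X₁ (X₂ ⊸ Y) S → Hom (X₁ ⊗ X₂) Y (image (graph α⁻¹) S)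
uncurry-tot X₁ X₂ Y S hom =
  hom-intro (X₁ ⊗ X₂) Y _ λ w tw →
  image-⊗-tot X₁ X₂ Y _ rectangles w tw
  where
  reassociate : ∀ u₁ u₂ → image (image S u₁) u₂ ⊆ image (image (graph α⁻¹) S) (u₁ ×ₛ u₂)
  reassociate _ _ (a₂ , ua₂ , a₁ , ua₁ , Sa₁a₂y) = _ , (ua₁ , ua₂) , _ , Sa₁a₂y , refl
  rectangles : ∀ u₁ u₂ → tot X₁ u₁ → tot X₂ u₂ →
               tot Y (image (image (graph α⁻¹) S) (u₁ ×ₛ u₂))
  rectangles u₁ u₂ tu₁ tu₂ =
    tot-upward Y (reassociate u₁ u₂)
      (hom-elim X₂ Y _ (hom-elim X₁ (X₂ ⊸ Y) S hom u₁ tu₁) u₂ tu₂)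

graph-∘-inverse : (X Y : NUTS) (f : web X → web Y) (g : web Y → web X) →
                  (∀ x → g (f x) ≡ x) →
                  _∘ᵣ_ {X} {Y} {X} (graph g) (graph f) ≐ idᵣ X
graph-∘-inverse X Y f g g∘f≗id = composite⊆id , id⊆composite
  where
  composite⊆id : _∘ᵣ_ {X} {Y} {X} (graph g) (graph f) ⊆ idᵣ X
  composite⊆id {x , _} (_ , refl , refl) = sym (g∘f≗id x)
  id⊆composite : idᵣ X ⊆ _∘ᵣ_ {X} {Y} {X} (graph g) (graph f)
  id⊆composite {x , _} refl = f x , refl , g∘f≗id x

lemma4p6 : (X₁ X₂ Y : NUTS) →
    IsIso ((X₁ ⊗ X₂) ⊸ Y) (X₁ ⊸ (X₂ ⊸ Y)) (graph α)
lemma4p6 X₁ X₂ Y =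
    hom-intro A B (graph α) (curry-tot X₁ X₂ Y)
  , graph α⁻¹
  , hom-intro B A (graph α⁻¹) (uncurry-tot X₁ X₂ Y)
  , graph-∘-inverse A B α α⁻¹ (λ _ → refl)
  , graph-∘-inverse B A α⁻¹ α (λ _ → refl)
  where
  A = (X₁ ⊗ X₂) ⊸ Y
  B = X₁ ⊸ (X₂ ⊸ Y)
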